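{- Assume the set of processes under consideration satisfies the aliased communication property. Then: (1) $\mathtt{sub}$ is $b_\alpha$-compatible, and $\mathtt{sub}$ is $b_\alpha^2,b_\tau$-compatible up to $\mathcal F_{\equiv}\circ\mathtt{res}$, i.e. $\mathtt{sub}\circ(b_\alpha^2\cap b_\tau)\subseteq b_\tau\circ\mathcal F_\equiv\circ\mathtt{res}\circ\mathtt{sub}$; (2) $\mathtt{inp}$ is $\overline{b}_\alpha,b_\tau$-compatible, i.e. $\mathtt{inp}\circ(\overline b_\alpha\cap b_\tau)\subseteq b_\tau\circ\mathtt{inp}$; (3) $\mathrm{id}\cup\mathtt{inp}$ is $\overline b_\alpha$-compatible up to $\mathtt{sub}$, i.e. $(\mathrm{id}\cup\mathtt{inp})\circ\overline b_\alpha\subseteq \overline b_\alpha\circ\mathtt{sub}\circ(\mathrm{id}\cup\mathtt{inp})$.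
   Context: $\pi$-calculus processes: $P ::= !G \mid P|P \mid (\nu a)P \mid G$, $G ::= \mathbf 0 \mid \bar a\langle b\rangle.P \mid a(b).P \mid \tau.P \mid G+G$, taken up to $\alpha$-conversion; $\equiv$ is standard structural congruence, $P\sigma$ is capture-avoiding application of a name substitution $\sigma$, $\mathrm{fn},\mathrm{bn},\mathrm n$ are free, bound, all names. Visible actions $\alpha ::= \bar a\langle b\rangle \mid \bar a(b)\ (\text{bound output}) \mid ab\ (\text{early input})$; actions $\mu::=\alpha\mid\tau$. Early LTS: $a(b).P\xrightarrow{ac}P\{c/b\}$; $\bar a\langle b\rangle.P\xrightarrow{\bar a\langle b\rangle}P$; if $!G|G\xrightarrow{\mu}P'$ then $!G\xrightarrow{\mu}P'$; if $P\xrightarrow{\bar a\langle b\rangle}P'$ and $b\ne a$ then $(\nu b)P\xrightarrow{\bar a(b)}P'$; if $G\xrightarrow\mu P'$ then $G+G'\xrightarrow\mu P'$ and $G'+G\xrightarrow\mu P'$; if $P\xrightarrow\mu P'$ and $a\notin\mathrm n(\mu)$ then $(\nu a)P\xrightarrow\mu(\nu a)P'$; if $P\xrightarrow\mu P'$ and $\mathrm{bn}(\mu)\cap\mathrm{fn}(Q)=\emptyset$ then $P|Q\xrightarrow\mu P'|Q$ (and symmetrically); if $P\xrightarrow{ab}P'$, $Q\xrightarrow{\bar a\langle b\rangle}Q'$ then $P|Q\xrightarrow\tau P'|Q'$; if $P\xrightarrow{ab}P'$, $Q\xrightarrow{\bar a(b)}Q'$, $b\notin\mathrm{fn}(P)$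 then $P|Q\xrightarrow\tau(\nu b)(P'|Q')$ (and symmetric versions). Aliased communication property (for a set of processes): for every process $P$ in it, (i) if $P\xrightarrow{\bar a\langle b\rangle}\xrightarrow{cb}P'$ then $P\sigma\xrightarrow\tau P'\sigma$ for every substitution $\sigma$ with $a\sigma=c\sigma$; (ii) if $P\xrightarrow{\bar a(b)}\xrightarrow{cb}P'$ then $P\sigma\xrightarrow\tau(\nu b)P'\sigma$ for every $\sigma$ with $a\sigma=c\sigma$. Functions on relations over processes: $s_\alpha(\mathcal R)=\{(P,Q)\mid$ for all visible $\alpha$ and $P'$, $P\xrightarrow\alpha P'$ implies $\exists Q'$, $Q\xrightarrow\alpha Q'$, $P'\mathcal R Q'\}$; $s_\tau$ likewise with $\tau$ only. $b_\alpha(\mathcal R)=\{(P,Q)\mid (P,Q)\in s_\alpha(\mathcal R),\ (Q,P)\in s_\alpha(\mathcal R^{ -1})\}$, $b_\tau$ likewise; $\overline b_\alpha=\mathrm{id}\cap b_\alpha$, i.e. $\overline b_\alpha(\mathcal R)=\mathcal R\cap b_\alpha(\mathcal R)$. $\mathcal F_S(\mathcal R)=S\mathcal R S^{ -1}$ (relational composition); $\mathtt{res}(\mathcal R)=\{((\nu\tilde a)P,(\nu\tilde a)Q)\mid P\mathcal RQ\}$ for finite (possibly empty) name sequences $\tilde a$; $\mathtt{sub}(\mathcal R)=\{(P\sigma,Q\sigma)\mid P\mathcal RQ,\ \sigma\text{ a substitution}\}$; $\mathtt{inp}(\mathcal R)=\{(a(b).P,a(b).Q)\mid P\mathcal RQ\}$.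 Composition, union and intersection of functions are pointwise; $g^2=g\circ g$. $f$ is $g$-compatible if $f\circ g\subseteq g\circ f$; $f$ is $g$-compatible up to $f'$ if $f'$ is extensive and $f\circ g\subseteq g\circ f'\circ f$; $f$ is $g,h$-compatible if $f\circ(g\cap h)\subseteq h\circ f$; $f$ is $g,h$-compatible up to $f'$ if $f'$ is extensive and $f\circ(g\cap h)\subseteq h\circ f'\circ f$. -}

module Defs where

-- pi-calculus with early LTS, processes taken up to alpha-conversion.
-- Alpha-conversion is built in by using (unscoped) de Bruijn indices:
-- names are natural numbers; each binder (restriction, input prefix,
-- and the bound name of a bound-output action) binds index 0 and shifts
-- the outer names by one.

open import Data.Nat using (ℕ; zero; suc)
open import Data.Product using (Σ; ∃; _×_; _,_)
open import Data.Sum using (_⊎_)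
open import Relation.Binary.PropositionalEquality using (_≡_)

infixr 6 _∣_
infixr 7 _⊕_

mutual
  data Proc : Set where
    !_  : Guard → Proc
    _∣_ : Proc → Proc → Proc
    ν_  : Proc → Proc            -- binds index 0
    grd : Guard → Proc

  data Guard : Set where
    nil  : Guard
    send : ℕ → ℕ → Proc → Guard   -- send a b P  =  ā⟨b⟩.P
    recv : ℕ → Proc → Guard       -- recv a P    =  a(b).P, b is index 0 in P
    tauP : Proc → Guard
    _⊕_  : Guard → Guard → Guard

Subst : Set
Subst = ℕ → ℕ

lift : Subst → Subst
lift σ zero    = zero
lift σ (suc n) = suc (σ n)

_▹_ : ℕ → Subst → Subst
(c ▹ σ) zero    = c
(c ▹ σ) (suc n) = σ n

idS : Subst
idS n = n

mutual
  renP : Subst → Proc → Proc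
  renP σ (! G)   = ! renG σ G
  renP σ (P ∣ Q) = renP σ P ∣ renP σ Q
  renP σ (ν P)   = ν renP (lift σ) P
  renP σ (grd G) = grd (renG σ G)

  renG : Subst → Guard → Guard
  renG σ nil          = nil
  renG σ (send a b P) = send (σ a) (σ b) (renP σ P)
  renG σ (recv a P)   = recv (σ a) (renP (lift σ) P)
  renG σ (tauP P)     = tauP (renP σ P)
  renG σ (G ⊕ H)      = renG σ G ⊕ renG σ H

shift : Proc → Proc
shift = renP suc

-- P{c/b} where b is the bound index 0
subst0 : ℕ → Proc → Proc
subst0 c = renP (c ▹ idS)

swap01 : Subst
swap01 zero          = suc zero
swap01 (suc zero)    = zero
swap01 (suc (suc n)) = suc (suc n)

swap : Proc → Proc
swap = renP swap01

nus : ℕ → Proc → Proc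
nus zero    P = P
nus (suc n) P = ν nus n P

infix 4 _≈_ _≈g_

mutual
  data _≈_ : Proc → Proc → Set where
    ≈-refl  : ∀ {P} → P ≈ P
    ≈-sym   : ∀ {P Q} → P ≈ Q → Q ≈ P
    ≈-trans : ∀ {P Q R} → P ≈ Q → Q ≈ R → P ≈ R
    ≈-par   : ∀ {P P' Q Q'} → P ≈ P' → Q ≈ Q' → P ∣ Q ≈ P' ∣ Q'
    ≈-nu    : ∀ {P P'} → P ≈ P' → ν P ≈ ν P'
    ≈-rep   : ∀ {G G'} → G ≈g G' → ! G ≈ ! G'
    ≈-grd   : ∀ {G G'} → G ≈g G' → grd G ≈ grd G'
    par-unit  : ∀ {P} → P ∣ grd nil ≈ P
    par-comm  : ∀ {P Q} → P ∣ Q ≈ Q ∣ P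
    par-assoc : ∀ {P Q R} → (P ∣ Q) ∣ R ≈ P ∣ (Q ∣ R)
    nu-nil    : ν grd nil ≈ grd nil
    nu-swap   : ∀ {P} → ν ν P ≈ ν ν swap P
    nu-extr   : ∀ {P Q} → ν (shift P ∣ Q) ≈ P ∣ ν Q   -- (νa)(P|Q) ≡ P|(νa)Q, a ∉ fn(P)
    rep-unf   : ∀ {G} → ! G ≈ ! G ∣ grd G

  data _≈g_ : Guard → Guard → Set where
    ≈g-refl  : ∀ {G} → G ≈g G
    ≈g-sym   : ∀ {G H} → G ≈g H → H ≈g G
    ≈g-trans : ∀ {G H K} → G ≈g H → H ≈g K → G ≈g K
    ≈g-send  : ∀ {a b P P'} → P ≈ P' → send a b P ≈g send a b P'
    ≈g-recv  : ∀ {a P P'} → P ≈ P' → recv a P ≈g recv a P'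
    ≈g-tau   : ∀ {P P'} → P ≈ P' → tauP P ≈g tauP P'
    ≈g-sum   : ∀ {G G' H H'} → G ≈g G' → H ≈g H' → G ⊕ H ≈g G' ⊕ H'
    sum-unit  : ∀ {G} → G ⊕ nil ≈g G
    sum-comm  : ∀ {G H} → G ⊕ H ≈g H ⊕ G
    sum-assoc : ∀ {G H K} → (G ⊕ H) ⊕ K ≈g G ⊕ (H ⊕ K)

data Act : Set where
  outA  : ℕ → ℕ → Act
  boutA : ℕ → Act        -- ā(b), b bound (index 0 in the target)
  inA   : ℕ → ℕ → Act
  τ     : Act

data Visible : Act → Set where
  v-out  : ∀ {a b} → Visible (outA a b)
  v-bout : ∀ {a}   → Visible (boutA a)
  v-in   : ∀ {a b} → Visible (inA a b)

-- side condition bn(μ) ∩ fn(Q) = ∅ of the parallel rule: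
-- for a bound output the other component is moved under the new binder
ext : Act → Proc → Proc
ext (boutA a) Q = shift Q
ext (outA a b) Q = Q
ext (inA a b) Q = Q
ext τ Q = Q

infix 3 _⟶[_]_

data _⟶[_]_ : Proc → Act → Proc → Set where
  t-in   : ∀ {a c P} → grd (recv a P) ⟶[ inA a c ] subst0 c P
  t-out  : ∀ {a b P} → grd (send a b P) ⟶[ outA a b ] P
  t-tau  : ∀ {P} → grd (tauP P) ⟶[ τ ] P
  t-rep  : ∀ {G μ P'} → (! G ∣ grd G) ⟶[ μ ] P' → ! G ⟶[ μ ] P'
  t-open : ∀ {P a P'} → P ⟶[ outA (suc a) zero ] P' → ν P ⟶[ boutA a ] P'
  t-suml : ∀ {G H μ P'} → grd G ⟶[ μ ] P' → grd (G ⊕ H) ⟶[ μ ] P'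
  t-sumr : ∀ {G H μ P'} → grd H ⟶[ μ ] P' → grd (G ⊕ H) ⟶[ μ ] P'
  -- restriction (restricted name = index 0, not occurring in the action)
  t-res-out  : ∀ {P a b P'} → P ⟶[ outA (suc a) (suc b) ] P' → ν P ⟶[ outA a b ] ν P'
  t-res-in   : ∀ {P a b P'} → P ⟶[ inA (suc a) (suc b) ] P' → ν P ⟶[ inA a b ] ν P'
  t-res-tau  : ∀ {P P'} → P ⟶[ τ ] P' → ν P ⟶[ τ ] ν P'
  t-res-bout : ∀ {P a P'} → P ⟶[ boutA (suc a) ] P' → ν P ⟶[ boutA a ] ν swap P'
  t-parl : ∀ {P Q μ P'} → P ⟶[ μ ] P' → P ∣ Q ⟶[ μ ] P' ∣ ext μ Q
  t-parr : ∀ {P Q μ Q'} → Q ⟶[ μ ] Q' → P ∣ Q ⟶[ μ ] ext μ P ∣ Q'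
  t-comml : ∀ {P Q a b P' Q'} → P ⟶[ inA a b ] P' → Q ⟶[ outA a b ] Q' → P ∣ Q ⟶[ τ ] P' ∣ Q'
  t-commr : ∀ {P Q a b P' Q'} → P ⟶[ outA a b ] P' → Q ⟶[ inA a b ] Q' → P ∣ Q ⟶[ τ ] P' ∣ Q'
  -- close (b ∉ fn(P) is expressed by letting shift P receive the fresh index 0)
  t-closel : ∀ {P Q a P' Q'} → shift P ⟶[ inA (suc a) zero ] P' → Q ⟶[ boutA a ] Q' → P ∣ Q ⟶[ τ ] ν (P' ∣ Q')
  t-closer : ∀ {P Q a P' Q'} → P ⟶[ boutA a ] P' → shift Q ⟶[ inA (suc a) zero ] Q' → P ∣ Q ⟶[ τ ] ν (P' ∣ Q')

AliasedComm : Proc → Set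
AliasedComm P =
  (∀ {a b c P₁ P'} → P ⟶[ outA a b ] P₁ → P₁ ⟶[ inA c b ] P' →
     (σ : Subst) → σ a ≡ σ c → renP σ P ⟶[ τ ] renP σ P')
  ×
  -- (ii) P -ā(b)-> -cb-> P'  ⇒  Pσ -τ-> (νb)(P'σ)  whenever aσ = cσ
  --      (b is index 0 in P₁, P'; c (≠ b) is suc c in that scope)
  (∀ {a c P₁ P'} → P ⟶[ boutA a ] P₁ → P₁ ⟶[ inA (suc c) zero ] P' →
     (σ : Subst) → σ a ≡ σ c → renP σ P ⟶[ τ ] ν renP (lift σ) P')

-- The set of processes under consideration: a predicate U on processes
-- closed under the operations used below (so that sub, res, inp and the
-- transition-based functions are functions on relations over U).

record IsProcessSet (U : Proc → Set) : Set where
  field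
    closed-sub  : ∀ (σ : Subst) {P} → U P → U (renP σ P)
    closed-nu   : ∀ {P} → U P → U (ν P)
    closed-recv : ∀ a {P} → U P → U (grd (recv a P))
    closed-step : ∀ {P μ P'} → U P → P ⟶[ μ ] P' → U P'

SatisfiesAliasedComm : (Proc → Set) → Set
SatisfiesAliasedComm U = ∀ P → U P → AliasedComm P

Rel : Set₁
Rel = Proc → Proc → Set

RelFun : Set₁
RelFun = Rel → Rel

infix 4 _⊆_
_⊆_ : Rel → Rel → Set
R ⊆ R' = ∀ {P Q} → R P Q → R' P Q

_⁻¹ : Rel → Rel
(R ⁻¹) P Q = R Q P

OnU : (Proc → Set) → Rel → Set
OnU U R = ∀ {P Q} → R P Q → U P × U Q

sα : Rel → Rel
sα R P Q = ∀ α → Visible α → ∀ P' → P ⟶[ α ] P' →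
           Σ Proc λ Q' → (Q ⟶[ α ] Q') × R P' Q'

sτ : Rel → Rel
sτ R P Q = ∀ P' → P ⟶[ τ ] P' → Σ Proc λ Q' → (Q ⟶[ τ ] Q') × R P' Q'

bα : (Proc → Set) → RelFun
bα U R P Q = U P × U Q × sα R P Q × sα (R ⁻¹) Q P

bτ : (Proc → Set) → RelFun
bτ U R P Q = U P × U Q × sτ R P Q × sτ (R ⁻¹) Q P

b̄α : (Proc → Set) → RelFun
b̄α U R P Q = R P Q × bα U R P Q

F≡ : (Proc → Set) → RelFun
F≡ U R P Q = U P × U Q × Σ Proc λ P' → Σ Proc λ Q' → (P ≈ P') × R P' Q' × (Q ≈ Q')

data Res (R : Rel) : Rel where
  res : ∀ (n : ℕ) {P Q} → R P Q → Res R (nus n P) (nus n Q)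

data Sub (R : Rel) : Rel where
  sub : ∀ (σ : Subst) {P Q} → R P Q → Sub R (renP σ P) (renP σ Q)

data Inp (R : Rel) : Rel where
  inp : ∀ (a : ℕ) {P Q} → R P Q → Inp R (grd (recv a P)) (grd (recv a Q))

Id : RelFun
Id R = R

_∘ᶠ_ : RelFun → RelFun → RelFun
(f ∘ᶠ g) R = f (g R)

_∪ᶠ_ : RelFun → RelFun → RelFun
(f ∪ᶠ g) R P Q = f R P Q ⊎ g R P Q

_∩ᶠ_ : RelFun → RelFun → RelFun
(f ∩ᶠ g) R P Q = f R P Q × g R P Q

_² : RelFun → RelFun
g ² = g ∘ᶠ g

Extensive : (Proc → Set) → RelFun → Set₁
Extensive U f = ∀ R → OnU U R → R ⊆ f R

Compatible : (Proc → Set) → RelFun → RelFun → Set₁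
Compatible U f g = ∀ R → OnU U R → f (g R) ⊆ g (f R)

CompatibleUpTo : (Proc → Set) → RelFun → RelFun → RelFun → Set₁
CompatibleUpTo U f g f' = Extensive U f' × (∀ R → OnU U R → f (g R) ⊆ g (f' (f R)))

Compatible₂ : (Proc → Set) → RelFun → RelFun → RelFun → Set₁
Compatible₂ U f g h = ∀ R → OnU U R → f ((g ∩ᶠ h) R) ⊆ h (f R)

Compatible₂UpTo : (Proc → Set) → RelFun → RelFun → RelFun → RelFun → Set₁
Compatible₂UpTo U f g h f' = Extensive U f' × (∀ R → OnU U R → f ((g ∩ᶠ h) R) ⊆ h (f' (f R)))

module Submission where

-- Every transition of Pσ is the σ-image of a transition of P, with one exception: a τ-step
-- of Pσ may come from an output on a and an input on c ≠ a of P that σ identifies.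
-- Hence a substitution closure of a bisimulation-like relation simulates visible steps
-- directly (inputs are handled by receiving a fresh name and renaming it afterwards), and
-- τ-steps either directly or, in the exceptional case, by letting Q answer the output and
-- the input separately and fusing them into a τ-step of Qσ by the aliased communication
-- property. Input prefixes have no τ-steps, and their input steps lead to instances of
-- the continuations.

open import Defs
open import Data.Product using (Σ; _×_; _,_; proj₁; proj₂)
open import Data.Sum using (inj₁; inj₂)
open import Data.Nat using (ℕ; zero; suc; pred; _⊔_; _<_; _≤_; s≤s; _≟_)
open import Data.Nat.Properties
  using (suc-injective; <-≤-trans; <⇒≢; m≤m⊔n; m≤n⊔m; m<n⇒m<n⊔o; m<n⇒m<o⊔n; n<1+n)
open import Data.Empty using (⊥-elim)
open import Relation.Nullary using (yes; no)
open import Relation.Binary.PropositionalEquality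
  using (_≡_; _≢_; refl; sym; trans; cong; cong₂; subst₂)

mutual
  renP-fusion : ∀ P {σ ρ θ : Subst} → (∀ n → σ (ρ n) ≡ θ n) → renP σ (renP ρ P) ≡ renP θ P
  renP-fusion (! G)   h = cong !_ (renG-fusion G h)
  renP-fusion (P ∣ Q) h = cong₂ _∣_ (renP-fusion P h) (renP-fusion Q h)
  renP-fusion (ν P)   h = cong ν_ (renP-fusion P (lift-fusion h))
  renP-fusion (grd G) h = cong grd (renG-fusion G h)

  renG-fusion : ∀ G {σ ρ θ : Subst} → (∀ n → σ (ρ n) ≡ θ n) → renG σ (renG ρ G) ≡ renG θ G
  renG-fusion nil          h = refl
  renG-fusion (send a b P) h = cong₂ (λ (x , y) → send x y) (cong₂ _,_ (h a) (h b)) (renP-fusion P h)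
  renG-fusion (recv a P)   h = cong₂ recv (h a) (renP-fusion P (lift-fusion h))
  renG-fusion (tauP P)     h = cong tauP (renP-fusion P h)
  renG-fusion (G ⊕ H)      h = cong₂ _⊕_ (renG-fusion G h) (renG-fusion H h)

  lift-fusion : ∀ {σ ρ θ : Subst} → (∀ n → σ (ρ n) ≡ θ n) → ∀ n → lift σ (lift ρ n) ≡ lift θ n
  lift-fusion h zero    = refl
  lift-fusion h (suc n) = cong suc (h n)

shift-renP : ∀ σ Q → renP (lift σ) (shift Q) ≡ shift (renP σ Q)
shift-renP σ Q = trans (renP-fusion Q λ _ → refl) (sym (renP-fusion Q λ _ → refl))

swap-renP : ∀ σ P → swap (renP (lift (lift σ)) P) ≡ renP (lift (lift σ)) (swap P)
swap-renP σ P = trans (renP-fusion P λ _ → refl) (sym (renP-fusion P swap-lift²))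
  where
  swap-lift² : ∀ n → lift (lift σ) (swap01 n) ≡ swap01 (lift (lift σ) n)
  swap-lift² zero          = refl
  swap-lift² (suc zero)    = refl
  swap-lift² (suc (suc n)) = refl

subst0-renP : ∀ σ c P → renP σ (subst0 c P) ≡ subst0 (σ c) (renP (lift σ) P)
subst0-renP σ c P = trans (renP-fusion P after) (sym (renP-fusion P before))
  where
  after : ∀ n → σ ((c ▹ idS) n) ≡ (σ c ▹ σ) n
  after zero    = refl
  after (suc n) = refl
  before : ∀ n → (σ c ▹ idS) (lift σ n) ≡ (σ c ▹ σ) n
  before zero    = refl
  before (suc n) = refl

mutual
  fnBound : Proc → ℕ
  fnBound (! G)   = fnBoundG G
  fnBound (P ∣ Q) = fnBound P ⊔ fnBound Q
  fnBound (ν P)   = pred (fnBound P)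
  fnBound (grd G) = fnBoundG G

  fnBoundG : Guard → ℕ
  fnBoundG nil          = 0
  fnBoundG (send a b P) = suc a ⊔ (suc b ⊔ fnBound P)
  fnBoundG (recv a P)   = suc a ⊔ pred (fnBound P)
  fnBoundG (tauP P)     = fnBound P
  fnBoundG (G ⊕ H)      = fnBoundG G ⊔ fnBoundG H

lift-cong-below : ∀ {n} {σ ρ : Subst} → (∀ k → k < pred n → σ k ≡ ρ k) →
                  ∀ k → k < n → lift σ k ≡ lift ρ k
lift-cong-below h zero    _         = refl
lift-cong-below {suc n} h (suc k) (s≤s k<n) = cong suc (h k k<n)

mutual
  renP-cong : ∀ P {σ ρ : Subst} → (∀ k → k < fnBound P → σ k ≡ ρ k) → renP σ P ≡ renP ρ P
  renP-cong (! G)   h = cong !_ (renG-cong G h)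
  renP-cong (P ∣ Q) h =
    cong₂ _∣_ (renP-cong P λ k p → h k (m<n⇒m<n⊔o (fnBound Q) p))
              (renP-cong Q λ k p → h k (m<n⇒m<o⊔n (fnBound P) p))
  renP-cong (ν P)   h = cong ν_ (renP-cong P (lift-cong-below h))
  renP-cong (grd G) h = cong grd (renG-cong G h)

  renG-cong : ∀ G {σ ρ : Subst} → (∀ k → k < fnBoundG G → σ k ≡ ρ k) → renG σ G ≡ renG ρ G
  renG-cong nil          h = refl
  renG-cong (send a b P) h =
    cong₂ (λ (x , y) → send x y)
      (cong₂ _,_ (h a (m<n⇒m<n⊔o (suc b ⊔ fnBound P) (n<1+n a)))
                 (h b (m<n⇒m<o⊔n (suc a) (m<n⇒m<n⊔o (fnBound P) (n<1+n b)))))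
      (renP-cong P λ k p → h k (m<n⇒m<o⊔n (suc a) (m<n⇒m<o⊔n (suc b) p)))
  renG-cong (recv a P)   h =
    cong₂ recv (h a (m<n⇒m<n⊔o (pred (fnBound P)) (n<1+n a)))
               (renP-cong P (lift-cong-below λ k p → h k (m<n⇒m<o⊔n (suc a) p)))
  renG-cong (tauP P)     h = cong tauP (renP-cong P h)
  renG-cong (G ⊕ H)      h =
    cong₂ _⊕_ (renG-cong G λ k p → h k (m<n⇒m<n⊔o (fnBoundG H) p))
              (renG-cong H λ k p → h k (m<n⇒m<o⊔n (fnBoundG G) p))

mutual
  renP-identity : ∀ P {σ : Subst} → (∀ n → σ n ≡ n) → renP σ P ≡ P
  renP-identity (! G)   h = cong !_ (renG-identity G h)
  renP-identity (P ∣ Q) h = cong₂ _∣_ (renP-identity P h) (renP-identity Q h)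
  renP-identity (ν P)   h = cong ν_ (renP-identity P (lift-identity h))
  renP-identity (grd G) h = cong grd (renG-identity G h)

  renG-identity : ∀ G {σ : Subst} → (∀ n → σ n ≡ n) → renG σ G ≡ G
  renG-identity nil          h = refl
  renG-identity (send a b P) h = cong₂ (λ (x , y) → send x y) (cong₂ _,_ (h a) (h b)) (renP-identity P h)
  renG-identity (recv a P)   h = cong₂ recv (h a) (renP-identity P (lift-identity h))
  renG-identity (tauP P)     h = cong tauP (renP-identity P h)
  renG-identity (G ⊕ H)      h = cong₂ _⊕_ (renG-identity G h) (renG-identity H h)

  lift-identity : ∀ {σ : Subst} → (∀ n → σ n ≡ n) → ∀ n → lift σ n ≡ n
  lift-identity h zero    = refl
  lift-identity h (suc n) = cong suc (h n)

update : Subst → ℕ → ℕ → Subst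
update σ x y n with n ≟ x
... | yes _ = y
... | no  _ = σ n

update-≡ : ∀ σ x y → update σ x y x ≡ y
update-≡ σ x y with x ≟ x
... | yes _  = refl
... | no x≢x = ⊥-elim (x≢x refl)

update-≢ : ∀ σ x y n → n ≢ x → update σ x y n ≡ σ n
update-≢ σ x y n n≢x with n ≟ x
... | yes n≡x = ⊥-elim (n≢x n≡x)
... | no  _   = refl

renP-update-fresh : ∀ P σ x y → fnBound P ≤ x → renP (update σ x y) P ≡ renP σ P
renP-update-fresh P σ x y P≤x =
  renP-cong P λ k k<P → update-≢ σ x y k (<⇒≢ (<-≤-trans k<P P≤x))

≡⇒≈ : ∀ {P Q} → P ≡ Q → P ≈ Q
≡⇒≈ refl = ≈-refl

⟶-resp-≡ : ∀ {P P₂ μ μ₂ X X₂} → P ≡ P₂ → μ ≡ μ₂ → X ≡ X₂ → P ⟶[ μ ] X → P₂ ⟶[ μ₂ ] X₂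
⟶-resp-≡ refl refl refl d = d

∣-injective : ∀ {P Q P' Q'} → P ∣ Q ≡ P' ∣ Q' → P ≡ P' × Q ≡ Q'
∣-injective refl = refl , refl

ν-injective : ∀ {P P'} → ν P ≡ ν P' → P ≡ P'
ν-injective refl = refl

!-injective : ∀ {G G'} → ! G ≡ ! G' → G ≡ G'
!-injective refl = refl

grd-⊕-injective : ∀ {G H G' H'} → grd (G ⊕ H) ≡ grd (G' ⊕ H') → grd G ≡ grd G' × grd H ≡ grd H'
grd-⊕-injective refl = refl , refl

grd-recv-injective : ∀ {a P a' P'} → grd (recv a P) ≡ grd (recv a' P') → a ≡ a' × P ≡ P'
grd-recv-injective refl = refl , refl

renAct : Subst → Act → Act
renAct σ (outA a b) = outA (σ a) (σ b)
renAct σ (boutA a)  = boutA (σ a)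
renAct σ (inA a b)  = inA (σ a) (σ b)
renAct σ τ          = τ

-- The target of a bound output lies under the new binder, so σ is lifted there.
liftᵇ : Act → Subst → Subst
liftᵇ (boutA _)  = lift
liftᵇ (outA _ _) σ = σ
liftᵇ (inA _ _)  σ = σ
liftᵇ τ          σ = σ

ext-renP : ∀ σ μ Q → ext (renAct σ μ) (renP σ Q) ≡ renP (liftᵇ μ σ) (ext μ Q)
ext-renP σ (outA a b) Q = refl
ext-renP σ (boutA a)  Q = sym (shift-renP σ Q)
ext-renP σ (inA a b)  Q = refl
ext-renP σ τ          Q = refl

⟶-renP : ∀ σ {P μ P'} → P ⟶[ μ ] P' → renP σ P ⟶[ renAct σ μ ] renP (liftᵇ μ σ) P'
⟶-renP σ (t-in {c = c} {P}) = ⟶-resp-≡ refl refl (sym (subst0-renP σ c P)) t-in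
⟶-renP σ t-out            = t-out
⟶-renP σ t-tau            = t-tau
⟶-renP σ (t-rep d)        = t-rep (⟶-renP σ d)
⟶-renP σ (t-open d)       = t-open (⟶-renP (lift σ) d)
⟶-renP σ (t-suml d)       = t-suml (⟶-renP σ d)
⟶-renP σ (t-sumr d)       = t-sumr (⟶-renP σ d)
⟶-renP σ (t-res-out d)    = t-res-out (⟶-renP (lift σ) d)
⟶-renP σ (t-res-in d)     = t-res-in (⟶-renP (lift σ) d)
⟶-renP σ (t-res-tau d)    = t-res-tau (⟶-renP (lift σ) d)
⟶-renP σ (t-res-bout {P' = P'} d) =
  ⟶-resp-≡ refl refl (cong ν_ (swap-renP σ P')) (t-res-bout (⟶-renP (lift σ) d))
⟶-renP σ (t-parl {Q = Q} {μ = μ} d) =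
  ⟶-resp-≡ refl refl (cong (_ ∣_) (ext-renP σ μ Q)) (t-parl (⟶-renP σ d))
⟶-renP σ (t-parr {P = P} {μ = μ} d) =
  ⟶-resp-≡ refl refl (cong (_∣ _) (ext-renP σ μ P)) (t-parr (⟶-renP σ d))
⟶-renP σ (t-comml d e) = t-comml (⟶-renP σ d) (⟶-renP σ e)
⟶-renP σ (t-commr d e) = t-commr (⟶-renP σ d) (⟶-renP σ e)
⟶-renP σ (t-closel {P = P} d e) =
  t-closel (⟶-resp-≡ (shift-renP σ P) refl refl (⟶-renP (lift σ) d)) (⟶-renP σ e)
⟶-renP σ (t-closer {Q = Q} d e) =
  t-closer (⟶-renP σ d) (⟶-resp-≡ (shift-renP σ Q) refl refl (⟶-renP (lift σ) e))

data RenOut (σ : Subst) (P : Proc) (a b : ℕ) (X : Proc) : Set where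
  ren-out : ∀ {a₀ b₀ P'} → P ⟶[ outA a₀ b₀ ] P' → σ a₀ ≡ a → σ b₀ ≡ b → X ≡ renP σ P' →
            RenOut σ P a b X

data RenBout (σ : Subst) (P : Proc) (a : ℕ) (X : Proc) : Set where
  ren-bout : ∀ {a₀ P'} → P ⟶[ boutA a₀ ] P' → σ a₀ ≡ a → X ≡ renP (lift σ) P' → RenBout σ P a X

data RenIn (ρ : Subst) (P : Proc) (c₀ : ℕ) (a : ℕ) (X : Proc) : Set where
  ren-in : ∀ {a₀ P'} → P ⟶[ inA a₀ c₀ ] P' → ρ a₀ ≡ a → X ≡ renP ρ P' → RenIn ρ P c₀ a X

data RenTau (σ : Subst) (P X : Proc) : Set where
  ren-τ     : ∀ {P'} → P ⟶[ τ ] P' → X ≡ renP σ P' → RenTau σ P X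
  ren-comm  : ∀ {a b c P₁ P'} → P ⟶[ outA a b ] P₁ → P₁ ⟶[ inA c b ] P' →
              σ a ≡ σ c → a ≢ c → X ≡ renP σ P' → RenTau σ P X
  -- Only up to ≈: a close inside a parallel component must have its restriction extruded.
  ren-close : ∀ {a c P₁ P'} → P ⟶[ boutA a ] P₁ → P₁ ⟶[ inA (suc c) zero ] P' →
              σ a ≡ σ c → a ≢ c → X ≈ ν renP (lift σ) P' → RenTau σ P X

Steps⊆ : Proc → Proc → Set
Steps⊆ P P₂ = ∀ {μ Y} → P ⟶[ μ ] Y → P₂ ⟶[ μ ] Y

RenOut-map : ∀ {σ P P₂ a b X} → Steps⊆ P P₂ → RenOut σ P a b X → RenOut σ P₂ a b X
RenOut-map f (ren-out o ea eb eq) = ren-out (f o) ea eb eq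

RenBout-map : ∀ {σ P P₂ a X} → Steps⊆ P P₂ → RenBout σ P a X → RenBout σ P₂ a X
RenBout-map f (ren-bout o ea eq) = ren-bout (f o) ea eq

RenIn-map : ∀ {ρ P P₂ c₀ a X} → Steps⊆ P P₂ → RenIn ρ P c₀ a X → RenIn ρ P₂ c₀ a X
RenIn-map f (ren-in i ea eq) = ren-in (f i) ea eq

RenTau-map : ∀ {σ P P₂ X} → Steps⊆ P P₂ → RenTau σ P X → RenTau σ P₂ X
RenTau-map f (ren-τ t eq)            = ren-τ (f t) eq
RenTau-map f (ren-comm o i e a≢c eq) = ren-comm (f o) i e a≢c eq
RenTau-map f (ren-close o i e a≢c x) = ren-close (f o) i e a≢c x

⟶-renP-out⁻¹ : ∀ σ P {a b X} → renP σ P ⟶[ outA a b ] X → RenOut σ P a b X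
⟶-renP-out⁻¹ σ (! G) (t-rep d) = RenOut-map t-rep (⟶-renP-out⁻¹ σ (! G ∣ grd G) d)
⟶-renP-out⁻¹ σ (P ∣ Q) (t-parl d) with ⟶-renP-out⁻¹ σ P d
... | ren-out o ea eb eq = ren-out (t-parl o) ea eb (cong (_∣ _) eq)
⟶-renP-out⁻¹ σ (P ∣ Q) (t-parr d) with ⟶-renP-out⁻¹ σ Q d
... | ren-out o ea eb eq = ren-out (t-parr o) ea eb (cong (_ ∣_) eq)
⟶-renP-out⁻¹ σ (ν P) (t-res-out d) with ⟶-renP-out⁻¹ (lift σ) P d
... | ren-out {suc a₀} {suc b₀} o ea eb eq =
  ren-out (t-res-out o) (suc-injective ea) (suc-injective eb) (cong ν_ eq)
⟶-renP-out⁻¹ σ (grd (send a b P)) t-out = ren-out t-out refl refl refl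
⟶-renP-out⁻¹ σ (grd (G ⊕ H)) (t-suml d) = RenOut-map t-suml (⟶-renP-out⁻¹ σ (grd G) d)
⟶-renP-out⁻¹ σ (grd (G ⊕ H)) (t-sumr d) = RenOut-map t-sumr (⟶-renP-out⁻¹ σ (grd H) d)

⟶-renP-bout⁻¹ : ∀ σ P {a X} → renP σ P ⟶[ boutA a ] X → RenBout σ P a X
⟶-renP-bout⁻¹ σ (! G) (t-rep d) = RenBout-map t-rep (⟶-renP-bout⁻¹ σ (! G ∣ grd G) d)
⟶-renP-bout⁻¹ σ (P ∣ Q) (t-parl d) with ⟶-renP-bout⁻¹ σ P d
... | ren-bout o ea eq = ren-bout (t-parl o) ea (cong₂ _∣_ eq (sym (shift-renP σ Q)))
⟶-renP-bout⁻¹ σ (P ∣ Q) (t-parr d) with ⟶-renP-bout⁻¹ σ Q d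
... | ren-bout o ea eq = ren-bout (t-parr o) ea (cong₂ _∣_ (sym (shift-renP σ P)) eq)
⟶-renP-bout⁻¹ σ (ν P) (t-open d) with ⟶-renP-out⁻¹ (lift σ) P d
... | ren-out {suc a₀} {zero} o ea refl eq = ren-bout (t-open o) (suc-injective ea) eq
⟶-renP-bout⁻¹ σ (ν P) (t-res-bout d) with ⟶-renP-bout⁻¹ (lift σ) P d
... | ren-bout {suc a₀} {P'} o ea refl = ren-bout (t-res-bout o) (suc-injective ea) (cong ν_ (swap-renP σ P'))
⟶-renP-bout⁻¹ σ (grd (G ⊕ H)) (t-suml d) = RenBout-map t-suml (⟶-renP-bout⁻¹ σ (grd G) d)
⟶-renP-bout⁻¹ σ (grd (G ⊕ H)) (t-sumr d) = RenBout-map t-sumr (⟶-renP-bout⁻¹ σ (grd H) d)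

-- An early input of Pσ is matched by an input of P of any chosen name c₀, and the step
-- is recovered by any ρ agreeing with σ on the free names of P (stated as Pρ ≡ Pσ)
-- and sending c₀ to the received name.
⟶-renP-in⁻¹ : ∀ σ P {a c X} → renP σ P ⟶[ inA a c ] X →
              ∀ ρ c₀ → renP ρ P ≡ renP σ P → ρ c₀ ≡ c → RenIn ρ P c₀ a X
⟶-renP-in⁻¹ σ (! G) (t-rep d) ρ c₀ eq e =
  RenIn-map t-rep (⟶-renP-in⁻¹ σ (! G ∣ grd G) d ρ c₀ (cong (λ H → ! H ∣ grd H) (!-injective eq)) e)
⟶-renP-in⁻¹ σ (P ∣ Q) (t-parl d) ρ c₀ eq e with ⟶-renP-in⁻¹ σ P d ρ c₀ (proj₁ (∣-injective eq)) e
... | ren-in i ea eqX = ren-in (t-parl i) ea (cong₂ _∣_ eqX (sym (proj₂ (∣-injective eq))))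
⟶-renP-in⁻¹ σ (P ∣ Q) (t-parr d) ρ c₀ eq e with ⟶-renP-in⁻¹ σ Q d ρ c₀ (proj₂ (∣-injective eq)) e
... | ren-in i ea eqX = ren-in (t-parr i) ea (cong₂ _∣_ (sym (proj₁ (∣-injective eq))) eqX)
⟶-renP-in⁻¹ σ (ν P) (t-res-in d) ρ c₀ eq e
  with ⟶-renP-in⁻¹ (lift σ) P d (lift ρ) (suc c₀) (ν-injective eq) (cong suc e)
... | ren-in {suc a₀} i ea eqX = ren-in (t-res-in i) (suc-injective ea) (cong ν_ eqX)
⟶-renP-in⁻¹ σ (grd (recv a P)) t-in ρ c₀ eq e =
  ren-in t-in (proj₁ (grd-recv-injective eq))
    (sym (trans (subst0-renP ρ c₀ P) (cong₂ subst0 e (proj₂ (grd-recv-injective eq)))))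
⟶-renP-in⁻¹ σ (grd (G ⊕ H)) (t-suml d) ρ c₀ eq e =
  RenIn-map t-suml (⟶-renP-in⁻¹ σ (grd G) d ρ c₀ (proj₁ (grd-⊕-injective eq)) e)
⟶-renP-in⁻¹ σ (grd (G ⊕ H)) (t-sumr d) ρ c₀ eq e =
  RenIn-map t-sumr (⟶-renP-in⁻¹ σ (grd H) d ρ c₀ (proj₂ (grd-⊕-injective eq)) e)

⟶-renP-τ⁻¹ : ∀ σ P {X} → renP σ P ⟶[ τ ] X → RenTau σ P X
⟶-renP-τ⁻¹ σ (! G) (t-rep d) = RenTau-map t-rep (⟶-renP-τ⁻¹ σ (! G ∣ grd G) d)
⟶-renP-τ⁻¹ σ (grd (tauP P)) t-tau = ren-τ t-tau refl
⟶-renP-τ⁻¹ σ (grd (G ⊕ H)) (t-suml d) = RenTau-map t-suml (⟶-renP-τ⁻¹ σ (grd G) d)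
⟶-renP-τ⁻¹ σ (grd (G ⊕ H)) (t-sumr d) = RenTau-map t-sumr (⟶-renP-τ⁻¹ σ (grd H) d)
⟶-renP-τ⁻¹ σ (ν P) (t-res-tau d) with ⟶-renP-τ⁻¹ (lift σ) P d
... | ren-τ t eq = ren-τ (t-res-tau t) (cong ν_ eq)
... | ren-comm {zero} {_} {zero} o i e a≢c eq = ⊥-elim (a≢c refl)
... | ren-comm {suc a} {zero} {suc c} o i e a≢c eq =
  ren-close (t-open o) i (suc-injective e) (λ p → a≢c (cong suc p)) (≡⇒≈ (cong ν_ eq))
... | ren-comm {suc a} {suc b} {suc c} o i e a≢c eq =
  ren-comm (t-res-out o) (t-res-in i) (suc-injective e) (λ p → a≢c (cong suc p)) (cong ν_ eq)
... | ren-close {zero} {zero} o i e a≢c x = ⊥-elim (a≢c refl)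
... | ren-close {suc a} {suc c} {P' = P'} o i e a≢c x =
  ren-close (t-res-bout o) (t-res-in (⟶-renP swap01 i)) (suc-injective e) (λ p → a≢c (cong suc p))
    (≈-trans (≈-nu x) (≈-trans nu-swap (≡⇒≈ (cong (λ Y → ν ν Y) (swap-renP σ P')))))
⟶-renP-τ⁻¹ σ (P ∣ Q) (t-parl d) with ⟶-renP-τ⁻¹ σ P d
... | ren-τ t eq = ren-τ (t-parl t) (cong (_∣ _) eq)
... | ren-comm o i e a≢c eq = ren-comm (t-parl o) (t-parl i) e a≢c (cong (_∣ _) eq)
... | ren-close {P' = P'} o i e a≢c x =
  ren-close (t-parl o) (t-parl i) e a≢c
    (≈-trans (≈-par x ≈-refl) (≈-trans par-comm (≈-trans (≈-sym nu-extr)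
      (≈-trans (≈-nu par-comm)
        (≡⇒≈ (cong (λ Y → ν (renP (lift σ) P' ∣ Y)) (sym (shift-renP σ Q))))))))
⟶-renP-τ⁻¹ σ (P ∣ Q) (t-parr d) with ⟶-renP-τ⁻¹ σ Q d
... | ren-τ t eq = ren-τ (t-parr t) (cong (_ ∣_) eq)
... | ren-comm o i e a≢c eq = ren-comm (t-parr o) (t-parr i) e a≢c (cong (_ ∣_) eq)
... | ren-close {P' = Q'} o i e a≢c x =
  ren-close (t-parr o) (t-parr i) e a≢c
    (≈-trans (≈-par ≈-refl x) (≈-trans (≈-sym nu-extr)
      (≡⇒≈ (cong (λ Y → ν (Y ∣ renP (lift σ) Q')) (sym (shift-renP σ P))))))
⟶-renP-τ⁻¹ σ (P ∣ Q) (t-comml d e) with ⟶-renP-out⁻¹ σ Q e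
... | ren-out {a₂} o refl refl refl with ⟶-renP-in⁻¹ σ P d σ _ refl refl
... | ren-in {a₁} i ea₁ eqX with a₁ ≟ a₂
... | yes refl = ren-τ (t-comml i o) (cong (_∣ _) eqX)
... | no a₁≢a₂ = ren-comm (t-parr o) (t-parl i) (sym ea₁) (λ p → a₁≢a₂ (sym p)) (cong (_∣ _) eqX)
⟶-renP-τ⁻¹ σ (P ∣ Q) (t-commr d e) with ⟶-renP-out⁻¹ σ P d
... | ren-out {a₂} o refl refl refl with ⟶-renP-in⁻¹ σ Q e σ _ refl refl
... | ren-in {a₁} i ea₁ eqX with a₁ ≟ a₂
... | yes refl = ren-τ (t-commr o i) (cong (_ ∣_) eqX)
... | no a₁≢a₂ = ren-comm (t-parl o) (t-parr i) (sym ea₁) (λ p → a₁≢a₂ (sym p)) (cong (_ ∣_) eqX)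
⟶-renP-τ⁻¹ σ (P ∣ Q) (t-closel d e) with ⟶-renP-bout⁻¹ σ Q e
... | ren-bout {a₂} b refl eqQ
  with ⟶-renP-in⁻¹ (lift σ) (shift P) (⟶-resp-≡ (sym (shift-renP σ P)) refl refl d) (lift σ) zero refl refl
... | ren-in {suc a₁} i ea₁ eqX with a₁ ≟ a₂
... | yes refl = ren-τ (t-closel i b) (cong ν_ (cong₂ _∣_ eqX eqQ))
... | no a₁≢a₂ = ren-close (t-parr b) (t-parl i) (sym (suc-injective ea₁)) (λ p → a₁≢a₂ (sym p))
                   (≡⇒≈ (cong ν_ (cong₂ _∣_ eqX eqQ)))
⟶-renP-τ⁻¹ σ (P ∣ Q) (t-closer d e) with ⟶-renP-bout⁻¹ σ P d
... | ren-bout {a₂} b refl eqP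
  with ⟶-renP-in⁻¹ (lift σ) (shift Q) (⟶-resp-≡ (sym (shift-renP σ Q)) refl refl e) (lift σ) zero refl refl
... | ren-in {suc a₁} i ea₁ eqX with a₁ ≟ a₂
... | yes refl = ren-τ (t-closer b i) (cong ν_ (cong₂ _∣_ eqP eqX))
... | no a₁≢a₂ = ren-close (t-parl b) (t-parr i) (sym (suc-injective ea₁)) (λ p → a₁≢a₂ (sym p))
                   (≡⇒≈ (cong ν_ (cong₂ _∣_ eqP eqX)))

sα-mono : ∀ {R R' : Rel} → R ⊆ R' → ∀ {P Q} → sα R P Q → sα R' P Q
sα-mono R⊆R' s α v P' d with s α v P' d
... | Q' , d' , r = Q' , d' , R⊆R' r

sτ-mono : ∀ {R R' : Rel} → R ⊆ R' → ∀ {P Q} → sτ R P Q → sτ R' P Q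
sτ-mono R⊆R' s P' d with s P' d
... | Q' , d' , r = Q' , d' , R⊆R' r

R⊆Sub : ∀ {R} → R ⊆ Sub R
R⊆Sub {R} {P} {Q} r =
  subst₂ (Sub R) (renP-identity P λ _ → refl) (renP-identity Q λ _ → refl) (sub idS r)

Sub-⁻¹ : ∀ {R} → Sub (R ⁻¹) ⊆ Sub R ⁻¹
Sub-⁻¹ (sub σ r) = sub σ r

-- The received name x is chosen fresh for P and Q, and then renamed to the actual one.
sα-Sub-inA : ∀ {R P Q} → sα R P Q → ∀ σ x → fnBound P ≤ x → fnBound Q ≤ x → ∀ {a c X} →
             renP σ P ⟶[ inA a c ] X → Σ Proc λ Y → (renP σ Q ⟶[ inA a c ] Y) × Sub R X Y
sα-Sub-inA {P = P} {Q} s σ x P≤x Q≤x {c = c} d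
  with ⟶-renP-in⁻¹ σ P d (update σ x c) x (renP-update-fresh P σ x c P≤x) (update-≡ σ x c)
... | ren-in {a₀} i refl refl with s (inA a₀ x) v-in _ i
... | Q' , i' , r =
  renP (update σ x c) Q' ,
  ⟶-resp-≡ (renP-update-fresh Q σ x c Q≤x) (cong (inA _) (update-≡ σ x c)) refl (⟶-renP (update σ x c) i') ,
  sub (update σ x c) r

sα-Sub : ∀ {R P Q} → sα R P Q → ∀ σ → sα (Sub R) (renP σ P) (renP σ Q)
sα-Sub {P = P} s σ (outA a b) v-out X d with ⟶-renP-out⁻¹ σ P d
... | ren-out {a₀} {b₀} o refl refl refl with s (outA a₀ b₀) v-out _ o
... | Q' , o' , r = renP σ Q' , ⟶-renP σ o' , sub σ r
sα-Sub {P = P} s σ (boutA a) v-bout X d with ⟶-renP-bout⁻¹ σ P d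
... | ren-bout {a₀} o refl refl with s (boutA a₀) v-bout _ o
... | Q' , o' , r = renP (lift σ) Q' , ⟶-renP σ o' , sub (lift σ) r
sα-Sub {P = P} {Q} s σ (inA a c) v-in X d =
  sα-Sub-inA s σ (fnBound P ⊔ fnBound Q) (m≤m⊔n _ _) (m≤n⊔m _ _) d

sα-recv : ∀ {R a P Q} → (∀ c → R (subst0 c P) (subst0 c Q)) → sα R (grd (recv a P)) (grd (recv a Q))
sα-recv R-inst α v P' (t-in {c = c}) = _ , t-in , R-inst c

bα⇒sα : ∀ {U R P Q} → bα U R P Q → sα R P Q
bα⇒sα (_ , _ , s , _) = s

bα⇒sα⁻¹ : ∀ {U R P Q} → bα U R P Q → sα (R ⁻¹) Q P
bα⇒sα⁻¹ (_ , _ , _ , s⁻) = s⁻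

F≡-Res-Sub-⁻¹ : ∀ {U R} → F≡ U (Res (Sub (R ⁻¹))) ⊆ F≡ U (Res (Sub R)) ⁻¹
F≡-Res-Sub-⁻¹ (uY , uX , Y' , X' , y , res n r , x) = uX , uY , X' , Y' , x , res n (Sub-⁻¹ r) , y

F≡-Res-extensive : ∀ {U} → Extensive U (F≡ U ∘ᶠ Res)
F≡-Res-extensive R onU r = proj₁ (onU r) , proj₂ (onU r) , _ , _ , ≈-refl , res 0 r , ≈-refl

module _ {U : Proc → Set} (ps : IsProcessSet U) where
  open IsProcessSet ps

  F≡-intro : ∀ {R P Q X Y} → U P → U Q → P ⟶[ τ ] X → Q ⟶[ τ ] Y → ∀ {X'} → X ≈ X' → R X' Y →
             Σ Proc λ Y' → (Q ⟶[ τ ] Y') × F≡ U R X Y'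
  F≡-intro uP uQ d t x r = _ , t , closed-step uP d , closed-step uQ t , _ , _ , x , r , ≈-refl

  sτ-Sub : SatisfiesAliasedComm U → ∀ {R P Q} → U P → U Q → sτ R P Q → sα (sα R) P Q → ∀ σ →
           sτ (F≡ U (Res (Sub R))) (renP σ P) (renP σ Q)
  sτ-Sub ac {P = P} {Q} uP uQ st s2 σ X d with ⟶-renP-τ⁻¹ σ P d
  ... | ren-τ t eq with st _ t
  ... | Q' , t' , r =
    F≡-intro (closed-sub σ uP) (closed-sub σ uQ) d (⟶-renP σ t') (≡⇒≈ eq) (res 0 (sub σ r))
  sτ-Sub ac {P = P} {Q} uP uQ st s2 σ X d | ren-comm {a} {b} {c} o i e _ eq with s2 (outA a b) v-out _ o
  ... | Q₁ , o' , s1 with s1 (inA c b) v-in _ i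
  ... | Q' , i' , r =
    F≡-intro (closed-sub σ uP) (closed-sub σ uQ) d (proj₁ (ac Q uQ) o' i' σ e) (≡⇒≈ eq) (res 0 (sub σ r))
  sτ-Sub ac {P = P} {Q} uP uQ st s2 σ X d | ren-close {a} {c} o i e _ x with s2 (boutA a) v-bout _ o
  ... | Q₁ , o' , s1 with s1 (inA (suc c) zero) v-in _ i
  ... | Q' , i' , r =
    F≡-intro (closed-sub σ uP) (closed-sub σ uQ) d (proj₂ (ac Q uQ) o' i' σ e) x (res 1 (sub (lift σ) r))

  Sub-bα : ∀ R → Sub (bα U R) ⊆ bα U (Sub R)
  Sub-bα R (sub σ (uP , uQ , s , s⁻)) =
    closed-sub σ uP , closed-sub σ uQ , sα-Sub s σ , sα-mono Sub-⁻¹ (sα-Sub s⁻ σ)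

  Sub-bα²∩bτ : SatisfiesAliasedComm U → ∀ R → Sub (((bα U ²) ∩ᶠ bτ U) R) ⊆ bτ U (F≡ U (Res (Sub R)))
  Sub-bα²∩bτ ac R (sub σ ((uP , uQ , s2 , s2⁻) , (_ , _ , st , st⁻))) =
    closed-sub σ uP , closed-sub σ uQ ,
    sτ-Sub ac uP uQ st (sα-mono bα⇒sα s2) σ ,
    sτ-mono F≡-Res-Sub-⁻¹ (sτ-Sub ac uQ uP st⁻ (sα-mono bα⇒sα⁻¹ s2⁻) σ)

  Inp-b̄α∩bτ : ∀ R → Inp ((b̄α U ∩ᶠ bτ U) R) ⊆ bτ U (Inp R)
  Inp-b̄α∩bτ R (inp a ((_ , uP , uQ , _) , _)) = closed-recv a uP , closed-recv a uQ , (λ _ ()) , (λ _ ())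

  Id∪Inp-b̄α : ∀ R → (Id ∪ᶠ Inp) (b̄α U R) ⊆ b̄α U (Sub ((Id ∪ᶠ Inp) R))
  Id∪Inp-b̄α R (inj₁ (r , uP , uQ , s , s⁻)) =
    R⊆Sub (inj₁ r) , uP , uQ , sα-mono (λ r' → R⊆Sub (inj₁ r')) s , sα-mono (λ r' → R⊆Sub (inj₁ r')) s⁻
  Id∪Inp-b̄α R (inj₂ (inp a (r , uP , uQ , _))) =
    R⊆Sub (inj₂ (inp a r)) , closed-recv a uP , closed-recv a uQ ,
    sα-recv (λ c → sub (c ▹ idS) (inj₁ r)) , sα-recv (λ c → sub (c ▹ idS) (inj₁ r))

lemma27 : (U : Proc → Set) → IsProcessSet U → SatisfiesAliasedComm U →
          (Compatible U Sub (bα U)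
             × Compatible₂UpTo U Sub ((bα U) ²) (bτ U) (F≡ U ∘ᶠ Res))
          × Compatible₂ U Inp (b̄α U) (bτ U)
          × CompatibleUpTo U (Id ∪ᶠ Inp) (b̄α U) Sub
lemma27 U ps ac =
  ( (λ R _ → Sub-bα ps R)
  , (F≡-Res-extensive , λ R _ → Sub-bα²∩bτ ps ac R))
  , (λ R _ → Inp-b̄α∩bτ ps R)
  , ((λ R _ → R⊆Sub) , λ R _ → Id∪Inp-b̄α ps R)
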